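{- $\mathrm{Aut}(AQ_4)\cong (D_8\times D_8)\rtimes C_2$.
   Context: $AQ_4$ is the Cayley graph $\mathrm{Cay}(\mathbb{Z}_2^4,S)$, i.e. the graph with vertex set $\mathbb{Z}_2^4$ (vectors written as bit strings) in which $x,y$ are adjacent iff $x+y\in S$, where $S=\{1000,0100,0010,0001,0011,0111,1111\}$. $D_8$ is the dihedral group of order 8, $C_2$ the cyclic group of order 2, and $(D_8\times D_8)\rtimes C_2$ is the group in which $C_2$ acts by swapping the two factors (the automorphism group of two disjoint 4-cycles). -}

module Defs where

open import Data.Bool using (Bool; true; false; _xor_)
open import Data.Vec using (Vec; []; _∷_; zipWith)
open import Data.List using (List; []; _∷_)
open import Data.List.Membership.Propositional using (_∈_)
open import Data.Product using (_×_; _,_; Σ; ∃)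
open import Relation.Binary.PropositionalEquality using (_≡_)

-- vertices: Z_2^4 as bit strings of length 4 (bit i = i-th character)
V : Set
V = Vec Bool 4

_⊕_ : V → V → V
_⊕_ = zipWith _xor_

S : List V
S = (true  ∷ false ∷ false ∷ false ∷ [])
  ∷ (false ∷ true  ∷ false ∷ false ∷ [])
  ∷ (false ∷ false ∷ true  ∷ false ∷ [])
  ∷ (false ∷ false ∷ false ∷ true  ∷ [])
  ∷ (false ∷ false ∷ true  ∷ true  ∷ [])
  ∷ (false ∷ true  ∷ true  ∷ true  ∷ [])
  ∷ (true  ∷ true  ∷ true  ∷ true  ∷ [])
  ∷ []

Adj : V → V → Set
Adj x y = (x ⊕ y) ∈ S

record Aut : Set where
  field
    fun   : V → V
    inv   : V → V
    left  : ∀ x → inv (fun x) ≡ x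
    right : ∀ x → fun (inv x) ≡ x
    pres  : ∀ x y → Adj x y → Adj (fun x) (fun y)
    refl' : ∀ x y → Adj (fun x) (fun y) → Adj x y
open Aut public

_≈ᴬ_ : Aut → Aut → Set
a ≈ᴬ b = ∀ x → fun a x ≡ fun b x

_∘ᴬ_ : Aut → Aut → Aut
fun (a ∘ᴬ b) x = fun a (fun b x)
inv (a ∘ᴬ b) x = inv b (inv a x)
left (a ∘ᴬ b) x rewrite left a (fun b x) = left b x
right (a ∘ᴬ b) x rewrite right b (inv a x) = right a x
pres (a ∘ᴬ b) x y h = pres a (fun b x) (fun b y) (pres b x y h)
refl' (a ∘ᴬ b) x y h = refl' b x y (refl' a (fun b x) (fun b y) h)

data Z4 : Set where
  z0 z1 z2 z3 : Z4

_+₄_ : Z4 → Z4 → Z4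
z0 +₄ b = b
z1 +₄ z0 = z1
z1 +₄ z1 = z2
z1 +₄ z2 = z3
z1 +₄ z3 = z0
z2 +₄ z0 = z2
z2 +₄ z1 = z3
z2 +₄ z2 = z0
z2 +₄ z3 = z1
z3 +₄ z0 = z3
z3 +₄ z1 = z0
z3 +₄ z2 = z1
z3 +₄ z3 = z2

-₄_ : Z4 → Z4
-₄ z0 = z0
-₄ z1 = z3
-₄ z2 = z2
-₄ z3 = z1

-- (k , e) represents r^k s^e
D8 : Set
D8 = Z4 × Bool

-- r^a s^e · r^b s^f = r^(a + (-1)^e b) s^(e+f)
_·D_ : D8 → D8 → D8
(a , false) ·D (b , f) = (a +₄ b , f)
(a , true)  ·D (b , f) = (a +₄ (-₄ b) , true xor f)

-- (D_8 × D_8) ⋊ C_2, with C_2 = Bool acting by swapping the factors: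
-- (x , σ)(y , τ) = (x · σ(y) , σ + τ)

W : Set
W = (D8 × D8) × Bool

_·W_ : W → W → W
((a , b) , false) ·W ((c , d) , t) = ((a ·D c , b ·D d) , t)
((a , b) , true)  ·W ((c , d) , t) = ((a ·D d , b ·D c) , true xor t)

record AutIso : Set where
  field
    φ          : Aut → W
    φ-cong     : ∀ a b → a ≈ᴬ b → φ a ≡ φ b
    φ-hom      : ∀ a b → φ (a ∘ᴬ b) ≡ φ a ·W φ b
    φ-injective : ∀ a b → φ a ≡ φ b → a ≈ᴬ b
    φ-surjective : ∀ w → Σ Aut (λ a → φ a ≡ w)

-- In suitable coordinates AQ_4 is the 4×4 rook's graph with each cell (i , j) also joined to
-- (i + 2 , j + 2).  The wreath product D_8 ≀ C_2 acts on it: a copy of D_8 acts on the columns as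
-- the symmetries of the square 00–01–11–10 formed by the last two bits, its conjugate by a linear
-- involution swapping rows and columns acts on the rows, and that involution is the C_2.
-- Conversely, a backtracking search through all partial maps that preserve equality and
-- adjacency lists every automorphism of AQ_4, and each one it finds agrees with one of these 128
-- maps; since the 128 maps are told apart by the images of 0000, 0001 and 1000, reading off those
-- images is a group isomorphism.
module Submission where

open import Data.Bool using (Bool; true; false; not; _xor_)
import Data.Bool.Properties as Bool
open import Data.List using (List; []; _∷_; _++_; map; filter; concatMap; cartesianProduct; find; reverse; reverseAcc)
import Data.List.Properties as List
open import Data.List.Membership.Propositional using (_∈_; lose)
open import Data.List.Membership.Propositional.Properties
  using (∈-++⁺ˡ; ∈-++⁺ʳ; ∈-map⁺; ∈-filter⁺; ∈-cartesianProduct⁺; ∈-concatMap⁺)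
import Data.List.Membership.DecPropositional as DecMembership
open import Data.List.Relation.Unary.All as All using (All; all?)
import Data.List.Relation.Unary.All.Properties as All
open import Data.List.Relation.Unary.Any using (here; there)
open import Data.List.Relation.Unary.Any.Properties using (reverse⁺)
open import Data.Maybe using (fromMaybe)
open import Data.Nat as ℕ using (ℕ)
open import Data.Product using (_×_; _,_; uncurry)
import Data.Product.Properties as Product
open import Data.Vec using (Vec; []; _∷_)
import Data.Vec.Properties as Vec
open import Function using (_⇔_; mk⇔; Equivalence; Injective)
open import Relation.Binary using (Decidable; DecidableEquality)
open import Relation.Binary.PropositionalEquality
open import Relation.Nullary using (Dec; yes; no; map′; _×-dec_; _→-dec_; contradiction)
open import Relation.Nullary.Decidable using (True; toWitness)
import Relation.Unary as U

open import Defs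

infix 3 _⇔-dec_

_⇔-dec_ : ∀ {A B : Set} → Dec A → Dec B → Dec (A ⇔ B)
a? ⇔-dec b? = map′ (uncurry mk⇔) (λ e → Equivalence.to e , Equivalence.from e)
                   ((a? →-dec b?) ×-dec (b? →-dec a?))

module _ {A : Set} {xs : List A} (∈-xs : ∀ x → x ∈ xs) where

  byExhaustion : {P : A → Set} (P? : U.Decidable P) → {True (all? P? xs)} → ∀ x → P x
  byExhaustion P? {all-P} x = All.lookup (toWitness all-P) (∈-xs x)

  byExhaustion₂ : {R : A → A → Set} (R? : Decidable R) →
                  {True (all? (λ x → all? (R? x) xs) xs)} → ∀ x y → R x y
  byExhaustion₂ R? {all-R} x y = All.lookup (All.lookup (toWitness all-R) (∈-xs x)) (∈-xs y)

∈-cartesianProduct : ∀ {A B : Set} {xs : List A} {ys : List B} →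
                     (∀ x → x ∈ xs) → (∀ y → y ∈ ys) → ∀ p → p ∈ cartesianProduct xs ys
∈-cartesianProduct ∈-xs ∈-ys (x , y) = ∈-cartesianProduct⁺ (∈-xs x) (∈-ys y)

bitStrings : ∀ n → List (Vec Bool n)
bitStrings ℕ.zero    = [] ∷ []
bitStrings (ℕ.suc n) = map (false ∷_) (bitStrings n) ++ map (true ∷_) (bitStrings n)

∈-bitStrings : ∀ {n} (x : Vec Bool n) → x ∈ bitStrings n
∈-bitStrings []          = here refl
∈-bitStrings (false ∷ x) = ∈-++⁺ˡ (∈-map⁺ (false ∷_) (∈-bitStrings x))
∈-bitStrings (true ∷ x)  = ∈-++⁺ʳ _ (∈-map⁺ (true ∷_) (∈-bitStrings x))

module PartialIsomorphisms {A : Set} (_≟_ : DecidableEquality A)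
                           {E : A → A → Set} (E? : Decidable E) (candidates : List A) where

  Compatible : A × A → A × A → Set
  Compatible (v , c) (u , d) = (v ≡ u ⇔ c ≡ d) × (E v u ⇔ E c d)

  compatible? : ∀ p q → Dec (Compatible p q)
  compatible? (v , c) (u , d) = (v ≟ u ⇔-dec c ≟ d) ×-dec (E? v u ⇔-dec E? c d)

  -- All extensions of σ to the domain list whose pairs are pairwise compatible; σ grows newest-first.
  extensions : List A → List (A × A) → List (List (A × A))
  extensions []       σ = σ ∷ []
  extensions (v ∷ vs) σ =
    concatMap (λ c → extensions vs ((v , c) ∷ σ))
              (filter (λ c → all? (compatible? (v , c)) σ) candidates)

  apply : List (A × A) → A → A
  apply []            x = x
  apply ((u , d) ∷ σ) x with x ≟ u
  ... | yes _ = d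
  ... | no  _ = apply σ x

  graphOn : (A → A) → List A → List (A × A)
  graphOn f = map (λ x → x , f x)

  apply-graphOn : ∀ f {xs x} → x ∈ xs → apply (graphOn f xs) x ≡ f x
  apply-graphOn f {u ∷ xs} {x} x∈ with x ≟ u | x∈
  ... | yes x≡u | _          = cong f (sym x≡u)
  ... | no  x≢u | here x≡u   = contradiction x≡u x≢u
  ... | no  _   | there x∈xs = apply-graphOn f x∈xs

  module _ (∈-candidates : ∀ c → c ∈ candidates)
           {f : A → A} (f-injective : Injective _≡_ _≡_ f)
           (f-E : ∀ x y → E x y ⇔ E (f x) (f y)) where

    graphOn-compatible : ∀ x y → Compatible (x , f x) (y , f y)
    graphOn-compatible x y = mk⇔ (cong f) f-injective , f-E x y

    extensions-complete : ∀ vs done → graphOn f (reverseAcc done vs) ∈ extensions vs (graphOn f done)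
    extensions-complete []       done = here refl
    extensions-complete (v ∷ vs) done =
      ∈-concatMap⁺ (λ c → extensions vs ((v , c) ∷ graphOn f done))
        (lose (∈-filter⁺ (λ c → all? (compatible? (v , c)) (graphOn f done))
                         (∈-candidates (f v))
                         (All.map⁺ (All.universal (graphOn-compatible v) done)))
              (extensions-complete vs (v ∷ done)))

module WreathAction {X : Set} (ρ : D8 → X → X) (σ : X → X)
  (ρ-hom        : ∀ p q x → ρ (p ·D q) x ≡ ρ p (ρ q x))
  (σ-involutive : ∀ x → σ (σ x) ≡ x)
  (ρ-commutes   : ∀ p q x → ρ p (σ (ρ q (σ x))) ≡ σ (ρ q (σ (ρ p x))))
  where

  ρᵀ : D8 → X → X
  ρᵀ q x = σ (ρ q (σ x))

  σ^ : Bool → X → X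
  σ^ false x = x
  σ^ true  x = σ x

  act : W → X → X
  act ((p , q) , t) x = ρ p (ρᵀ q (σ^ t x))

  ρᵀ-hom : ∀ p q x → ρᵀ (p ·D q) x ≡ ρᵀ p (ρᵀ q x)
  ρᵀ-hom p q x = cong σ (trans (ρ-hom p q (σ x)) (cong (ρ p) (sym (σ-involutive _))))

  σ-ρ : ∀ p x → σ (ρ p x) ≡ ρᵀ p (σ x)
  σ-ρ p x = cong (λ y → σ (ρ p y)) (sym (σ-involutive x))

  σ-ρᵀ : ∀ p x → σ (ρᵀ p x) ≡ ρ p (σ x)
  σ-ρᵀ p x = σ-involutive _

  σ-σ^ : ∀ t x → σ (σ^ t x) ≡ σ^ (not t) x
  σ-σ^ false x = refl
  σ-σ^ true  x = σ-involutive x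

  act-hom : ∀ w w′ x → act (w ·W w′) x ≡ act w (act w′ x)
  act-hom ((a , b) , false) ((c , d) , t) x = begin
    ρ (a ·D c) (ρᵀ (b ·D d) y)      ≡⟨ ρ-hom a c _ ⟩
    ρ a (ρ c (ρᵀ (b ·D d) y))       ≡⟨ cong (λ z → ρ a (ρ c z)) (ρᵀ-hom b d y) ⟩
    ρ a (ρ c (ρᵀ b (ρᵀ d y)))       ≡⟨ cong (ρ a) (ρ-commutes c b _) ⟩
    ρ a (ρᵀ b (ρ c (ρᵀ d y)))       ∎
    where open ≡-Reasoning; y = σ^ t x
  act-hom ((a , b) , true) ((c , d) , t) x = begin
    ρ (a ·D d) (ρᵀ (b ·D c) y)      ≡⟨ ρ-hom a d _ ⟩
    ρ a (ρ d (ρᵀ (b ·D c) y))       ≡⟨ cong (λ z → ρ a (ρ d z)) (ρᵀ-hom b c y) ⟩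
    ρ a (ρ d (ρᵀ b (ρᵀ c y)))       ≡⟨ cong (ρ a) (ρ-commutes d b _) ⟩
    ρ a (ρᵀ b (ρ d (ρᵀ c y)))       ≡⟨ cong (λ z → ρ a (ρᵀ b z)) (ρ-commutes d c y) ⟩
    ρ a (ρᵀ b (ρᵀ c (ρ d y)))       ≡⟨ cong (λ z → ρ a (ρᵀ b (ρᵀ c (ρ d z)))) (sym (σ-σ^ t x)) ⟩
    ρ a (ρᵀ b (ρᵀ c (ρ d (σ z))))   ≡⟨ cong (λ u → ρ a (ρᵀ b (ρᵀ c u))) (sym (σ-ρᵀ d z)) ⟩
    ρ a (ρᵀ b (ρᵀ c (σ (ρᵀ d z))))  ≡⟨ cong (λ u → ρ a (ρᵀ b u)) (sym (σ-ρ c (ρᵀ d z))) ⟩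
    ρ a (ρᵀ b (σ (ρ c (ρᵀ d z))))   ∎
    where open ≡-Reasoning; y = σ^ (not t) x; z = σ^ t x

toℕ₄ : Z4 → ℕ
toℕ₄ z0 = 0
toℕ₄ z1 = 1
toℕ₄ z2 = 2
toℕ₄ z3 = 3

fromℕ₄ : ℕ → Z4
fromℕ₄ 0 = z0
fromℕ₄ 1 = z1
fromℕ₄ 2 = z2
fromℕ₄ _ = z3

fromℕ₄-toℕ₄ : ∀ k → fromℕ₄ (toℕ₄ k) ≡ k
fromℕ₄-toℕ₄ z0 = refl
fromℕ₄-toℕ₄ z1 = refl
fromℕ₄-toℕ₄ z2 = refl
fromℕ₄-toℕ₄ z3 = refl

_≟₄_ : DecidableEquality Z4
k ≟₄ l = map′ toℕ₄-injective (cong toℕ₄) (toℕ₄ k ℕ.≟ toℕ₄ l)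
  where
  toℕ₄-injective : toℕ₄ k ≡ toℕ₄ l → k ≡ l
  toℕ₄-injective e = trans (sym (fromℕ₄-toℕ₄ k)) (trans (cong fromℕ₄ e) (fromℕ₄-toℕ₄ l))

_≟D_ : DecidableEquality D8
_≟D_ = Product.≡-dec _≟₄_ Bool._≟_

_≟W_ : DecidableEquality W
_≟W_ = Product.≡-dec (Product.≡-dec _≟D_ _≟D_) Bool._≟_

_≟V_ : DecidableEquality V
_≟V_ = Vec.≡-dec Bool._≟_

bools : List Bool
bools = false ∷ true ∷ []

∈-bools : ∀ b → b ∈ bools
∈-bools false = here refl
∈-bools true  = there (here refl)

z4s : List Z4
z4s = z0 ∷ z1 ∷ z2 ∷ z3 ∷ []

∈-z4s : ∀ k → k ∈ z4s
∈-z4s z0 = here refl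
∈-z4s z1 = there (here refl)
∈-z4s z2 = there (there (here refl))
∈-z4s z3 = there (there (there (here refl)))

vertices : List V
vertices = bitStrings 4

∈-vertices : ∀ x → x ∈ vertices
∈-vertices = ∈-bitStrings

dihedral : List D8
dihedral = cartesianProduct z4s bools

∈-dihedral : ∀ p → p ∈ dihedral
∈-dihedral = ∈-cartesianProduct ∈-z4s ∈-bools

wreath : List W
wreath = cartesianProduct (cartesianProduct dihedral dihedral) bools

∈-wreath : ∀ w → w ∈ wreath
∈-wreath = ∈-cartesianProduct (∈-cartesianProduct ∈-dihedral ∈-dihedral) ∈-bools

adj? : Decidable Adj
adj? x y = x ⊕ y ∈? S
  where open DecMembership _≟V_ using (_∈?_)

fromInverses : ∀ (f g : V → V) → (∀ x → g (f x) ≡ x) → (∀ x → f (g x) ≡ x) →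
               (∀ x y → Adj x y ⇔ Adj (f x) (f y)) → Aut
fromInverses f g g∘f f∘g f-adj = record
  { fun   = f
  ; inv   = g
  ; left  = g∘f
  ; right = f∘g
  ; pres  = λ x y → Equivalence.to (f-adj x y)
  ; refl' = λ x y → Equivalence.from (f-adj x y)
  }

involution : ∀ (f : V → V) → (∀ x → f (f x) ≡ x) → (∀ x y → Adj x y ⇔ Adj (f x) (f y)) → Aut
involution f f∘f = fromInverses f f f∘f f∘f

idᴬ : Aut
idᴬ = involution (λ x → x) (λ _ → refl) (λ _ _ → mk⇔ (λ e → e) (λ e → e))

-- On the last two bits, rotate is the rotation 00 → 01 → 11 → 10 → 00 of the square and reflect a
-- reflection of it; transpose is the linear involution exchanging rows and columns.
rotate unrotate reflect transpose : V → V
rotate    (a ∷ b ∷ c ∷ d ∷ []) = a ∷ b ∷ d ∷ not c ∷ []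
unrotate  (a ∷ b ∷ c ∷ d ∷ []) = a ∷ b ∷ not d ∷ c ∷ []
reflect   (a ∷ b ∷ c ∷ d ∷ []) = a ∷ b ∷ d ∷ c ∷ []
transpose (a ∷ b ∷ c ∷ d ∷ []) = (c xor d) ∷ (b xor c) ∷ c ∷ (a xor c) ∷ []

rotation reflection transposition : Aut
rotation = fromInverses rotate unrotate
  (byExhaustion ∈-vertices λ x → unrotate (rotate x) ≟V x)
  (byExhaustion ∈-vertices λ x → rotate (unrotate x) ≟V x)
  (byExhaustion₂ ∈-vertices λ x y → adj? x y ⇔-dec adj? (rotate x) (rotate y))
reflection = involution reflect
  (byExhaustion ∈-vertices λ x → reflect (reflect x) ≟V x)
  (byExhaustion₂ ∈-vertices λ x y → adj? x y ⇔-dec adj? (reflect x) (reflect y))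
transposition = involution transpose
  (byExhaustion ∈-vertices λ x → transpose (transpose x) ≟V x)
  (byExhaustion₂ ∈-vertices λ x y → adj? x y ⇔-dec adj? (transpose x) (transpose y))

rotations : Z4 → Aut
rotations z0 = idᴬ
rotations z1 = rotation
rotations z2 = rotation ∘ᴬ rotation
rotations z3 = rotation ∘ᴬ rotations z2

reflections : Bool → Aut
reflections false = idᴬ
reflections true  = reflection

transpositions : Bool → Aut
transpositions false = idᴬ
transpositions true  = transposition

onColumns : D8 → Aut
onColumns (k , e) = rotations k ∘ᴬ reflections e

onRows : D8 → Aut
onRows q = transposition ∘ᴬ (onColumns q ∘ᴬ transposition)

realise : W → Aut
realise ((p , q) , t) = onColumns p ∘ᴬ (onRows q ∘ᴬ transpositions t)

dihedralPairsAndVertices : List ((D8 × D8) × V)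
dihedralPairsAndVertices = cartesianProduct (cartesianProduct dihedral dihedral) vertices

∈-dihedralPairsAndVertices : ∀ e → e ∈ dihedralPairsAndVertices
∈-dihedralPairsAndVertices = ∈-cartesianProduct (∈-cartesianProduct ∈-dihedral ∈-dihedral) ∈-vertices

onColumns-hom : ∀ p q x → fun (onColumns (p ·D q)) x ≡ fun (onColumns p) (fun (onColumns q) x)
onColumns-hom p q x = byExhaustion ∈-dihedralPairsAndVertices
  (λ ((p , q) , x) → fun (onColumns (p ·D q)) x ≟V fun (onColumns p) (fun (onColumns q) x))
  ((p , q) , x)

onColumns-onRows : ∀ p q x → fun (onColumns p) (fun (onRows q) x) ≡ fun (onRows q) (fun (onColumns p) x)
onColumns-onRows p q x = byExhaustion ∈-dihedralPairsAndVertices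
  (λ ((p , q) , x) → fun (onColumns p) (fun (onRows q) x) ≟V fun (onRows q) (fun (onColumns p) x))
  ((p , q) , x)

open WreathAction (λ p → fun (onColumns p)) (fun transposition)
                  onColumns-hom (left transposition) onColumns-onRows

realise-act : ∀ w → fun (realise w) ≗ act w
realise-act ((p , q) , false) x = refl
realise-act ((p , q) , true)  x = refl

realise-hom : ∀ w w′ x → fun (realise (w ·W w′)) x ≡ fun (realise w) (fun (realise w′) x)
realise-hom w w′ x = begin
  fun (realise (w ·W w′)) x             ≡⟨ realise-act (w ·W w′) x ⟩
  act (w ·W w′) x                       ≡⟨ act-hom w w′ x ⟩
  act w (act w′ x)                      ≡⟨ sym (realise-act w _) ⟩
  fun (realise w) (act w′ x)            ≡⟨ cong (fun (realise w)) (sym (realise-act w′ x)) ⟩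
  fun (realise w) (fun (realise w′) x)  ∎
  where open ≡-Reasoning

base : List V
base = (false ∷ false ∷ false ∷ false ∷ [])
     ∷ (false ∷ false ∷ false ∷ true ∷ [])
     ∷ (true ∷ false ∷ false ∷ false ∷ [])
     ∷ []

-- The default value is only reached for image lists no element of W produces.
locate : List V → W
locate images = fromMaybe (((z0 , false) , (z0 , false)) , false)
  (find (λ w → List.≡-dec _≟V_ (map (fun (realise w)) base) images) wreath)

locate-realise : ∀ w → locate (map (fun (realise w)) base) ≡ w
locate-realise = byExhaustion ∈-wreath λ w → locate (map (fun (realise w)) base) ≟W w

open PartialIsomorphisms _≟V_ adj? vertices

Realised : List (V × V) → Set
Realised σ = All (λ x → apply σ x ≡ fun (realise (locate (map (apply σ) base))) x) vertices

realised? : U.Decidable Realised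
realised? σ = all? (λ x → apply σ x ≟V fun (realise (locate (map (apply σ) base))) x) vertices

extensions-realised : All Realised (extensions vertices [])
extensions-realised = toWitness {a? = all? realised? (extensions vertices [])} _

fun-injective : ∀ a → Injective _≡_ _≡_ (fun a)
fun-injective a {x} {y} e = trans (sym (left a x)) (trans (cong (inv a) e) (left a y))

φ : Aut → W
φ a = locate (map (fun a) base)

fun≗realise∘φ : ∀ a → fun a ≗ fun (realise (φ a))
fun≗realise∘φ a x = begin
  fun a x                                        ≡⟨ sym (apply-graphOn (fun a) (reverse⁺ (∈-vertices x))) ⟩
  apply σ x                                      ≡⟨ All.lookup (All.lookup extensions-realised σ-leaf) (∈-vertices x) ⟩
  fun (realise (locate (map (apply σ) base))) x  ≡⟨ cong (λ images → fun (realise (locate images)) x)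
                                                         (List.map-cong apply-σ base) ⟩
  fun (realise (φ a)) x                          ∎
  where
  open ≡-Reasoning
  σ = graphOn (fun a) (reverse vertices)
  apply-σ : apply σ ≗ fun a
  apply-σ y = apply-graphOn (fun a) (reverse⁺ (∈-vertices y))
  σ-leaf : σ ∈ extensions vertices []
  σ-leaf = extensions-complete ∈-vertices (fun-injective a)
             (λ x y → mk⇔ (pres a x y) (refl' a x y)) vertices []

φ-unique : ∀ a w → fun a ≗ fun (realise w) → φ a ≡ w
φ-unique a w a≗w = trans (cong locate (List.map-cong a≗w base)) (locate-realise w)

mainTheorem9 : AutIso
mainTheorem9 = record
  { φ            = φ
  ; φ-cong       = λ a b a≈b → cong locate (List.map-cong a≈b base)
  ; φ-hom        = λ a b → φ-unique (a ∘ᴬ b) (φ a ·W φ b) λ x → begin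
      fun a (fun b x)                              ≡⟨ cong (fun a) (fun≗realise∘φ b x) ⟩
      fun a (fun (realise (φ b)) x)                ≡⟨ fun≗realise∘φ a _ ⟩
      fun (realise (φ a)) (fun (realise (φ b)) x)  ≡⟨ sym (realise-hom (φ a) (φ b) x) ⟩
      fun (realise (φ a ·W φ b)) x                 ∎
  ; φ-injective  = λ a b φa≡φb x → begin
      fun a x                ≡⟨ fun≗realise∘φ a x ⟩
      fun (realise (φ a)) x  ≡⟨ cong (λ w → fun (realise w) x) φa≡φb ⟩
      fun (realise (φ b)) x  ≡⟨ sym (fun≗realise∘φ b x) ⟩
      fun b x                ∎
  ; φ-surjective = λ w → realise w , φ-unique (realise w) w (λ _ → refl)
  }
  where open ≡-Reasoning
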